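{- Let $n \geq 2$ and let $s=(s_1,s_2,\ldots,s_n)$ be a sequence of numbers from $\{0,1,2\}$. Then the cardinality of the set \[ \{(x_1,\ldots,x_n)\in \{0,1\}^n \mid x_1+x_2\neq s_1,\ x_2+x_3\neq s_2,\ \ldots,\ x_{n-1}+x_n\neq s_{n-1}\ \textrm{and}\ x_n+x_1\neq s_n\} \] is at most $\ell(n)$.
   Context: The Fibonacci numbers are defined for all integers by $\varphi(0)=0$, $\varphi(1)=1$ and $\varphi(n)=\varphi(n-1)+\varphi(n-2)$; the Lucas numbers are $\ell(n)=\varphi(n-1)+\varphi(n+1)$ (so $\ell(2)=3$, $\ell(3)=4$, $\ell(4)=7$, ...). -}

module Defs where

open import Data.Nat using (ℕ; zero; suc; _+_; _≟_)
open import Data.Vec using (Vec; []; _∷_)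
open import Data.List using (List; []; _∷_; map; _++_; filter; length)
open import Data.List.Relation.Unary.All using (All; all?)
open import Data.Product using (_×_; _,_)
open import Relation.Nullary using (¬_; Dec)
open import Relation.Nullary.Decidable using (¬?)

fib : ℕ → ℕ
fib zero = 0
fib (suc zero) = 1
fib (suc (suc n)) = fib (suc n) + fib n

-- Lucas numbers ℓ(n) = φ(n-1) + φ(n+1), defined here for n ≥ 1
-- via lucas (suc m) = φ m + φ (m+2); lucas 0 = 2 (= φ(-1) + φ(1)).
lucas : ℕ → ℕ
lucas zero = 2
lucas (suc m) = fib m + fib (suc (suc m))

binVecs : (n : ℕ) → List (Vec ℕ n)
binVecs zero = [] ∷ []
binVecs (suc n) = map (0 ∷_) (binVecs n) ++ map (1 ∷_) (binVecs n)

-- the list of triples (x_i , x_{i+1} , s_i) for i = 1..n with indices cyclic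
-- (x_{n+1} = x_1), from x = (x_1..x_n), s = (s_1..s_n)
-- chain first x s: triples (x_i, x_{i+1}, s_i) where the successor of the last is 'first'
chain : {n : ℕ} → ℕ → Vec ℕ n → Vec ℕ n → List (ℕ × ℕ × ℕ)
chain f [] [] = []
chain f (a ∷ []) (t ∷ []) = (a , f , t) ∷ []
chain f (a ∷ b ∷ xs) (t ∷ ts) = (a , b , t) ∷ chain f (b ∷ xs) ts

cycTriples : {n : ℕ} → Vec ℕ n → Vec ℕ n → List (ℕ × ℕ × ℕ)
cycTriples [] [] = []
cycTriples (a ∷ xs) s = chain a (a ∷ xs) s

open import Relation.Binary.PropositionalEquality using (_≡_)

avoids : ℕ × ℕ × ℕ → Set
avoids (a , b , t) = ¬ (a + b ≡ t)

avoids? : (p : ℕ × ℕ × ℕ) → Dec (avoids p)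
avoids? (a , b , t) = ¬? (a + b ≟ t)

Good : {n : ℕ} → Vec ℕ n → Vec ℕ n → Set
Good s x = All avoids (cycTriples x s)

Good? : {n : ℕ} (s x : Vec ℕ n) → Dec (Good s x)
Good? s x = all? avoids? (cycTriples x s)

cardGood : {n : ℕ} → Vec ℕ n → ℕ
cardGood {n} s = length (filter (Good? s) (binVecs n))

module Submission where

-- The constraint x_i + x_{i+1} ≠ s_i couples neighbouring bits only,
-- so the admissible cyclic words are counted by a trace of transfer matrices:
--   cardGood s = tr (M s₁ · M s₂ ⋯ M sₙ),   M t = ([x + y ≠ t]) for x, y ∈ {0,1}.
-- Here M 1 is the identity, M 0 = (0 1 / 1 1) and M 2 = (1 1 / 1 0).  For every
-- word w over {0,1,2} we bound tr (M w₁ ⋯ M wₙ) by ℓ(n) (by 2 when n ≤ 1),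
-- by induction on n, using that the trace is invariant under rotation:
--   * a letter 1 can be deleted, since M 1 is the identity;
--   * an adjacent pair 0 2 (or 2 0) contributes M 0 · M 2 = (1 0 / 2 1), so the
--     trace equals tr P + 2·(an off-diagonal entry of P), where P is the product
--     of the other n - 2 letters; entries of P are at most φ(n-1), and
--     ℓ(n-2) + 2φ(n-1) ≤ ℓ(n);
--   * otherwise the word is constant, the product is a power of M 0 or of M 2,
--     and its trace is exactly ℓ(n).

open import Defs
open import Data.Nat using (ℕ; zero; suc; _+_; _*_; _≤_; z≤n; s≤s)
open import Data.Nat.Properties
open import Data.Nat.Tactic.RingSolver using (solve-∀)
open import Data.Bool using (Bool; true; false; _∧_)
open import Data.Bool.Properties using (∧-identityʳ)
open import Data.List using (List; []; _∷_; _++_; length; filter; map)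
open import Data.List.Properties using (filter-++; length-++; length-++-sucʳ; length-++-comm)
open import Data.List.Relation.Unary.All using ([]; _∷_; all?)
import Data.List.Relation.Unary.All as List
open import Data.List.Relation.Unary.All.Properties using (++⁺; ++⁻ˡ; ++⁻ʳ)
open import Data.Vec using (Vec; []; _∷_; toList)
open import Data.Vec.Properties using (length-toList)
open import Data.Vec.Relation.Unary.All using (All)
open import Data.Vec.Relation.Unary.All.Properties using (toList⁺)
open import Data.Product using (_×_; _,_; proj₁; proj₂)
open import Function using (_∘_)
open import Relation.Nullary using (does)
open import Relation.Unary using (Decidable)
open import Relation.Binary.PropositionalEquality

-- A Boolean as a bit 0 or 1; it is both a coordinate value and an indicator.
bit : Bool → ℕ
bit false = 0
bit true  = 1

countBin : (n : ℕ) → (Vec ℕ n → Bool) → ℕ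
countBin zero    p = bit (p [])
countBin (suc n) p = countBin n (λ x → p (0 ∷ x)) + countBin n (λ x → p (1 ∷ x))

length-filter-map : {A B : Set} {P : B → Set} (P? : Decidable P) (h : A → B) (l : List A) →
  length (filter P? (map h l)) ≡ length (filter (P? ∘ h) l)
length-filter-map P? h []      = refl
length-filter-map P? h (x ∷ l) with does (P? (h x))
... | true  = cong suc (length-filter-map P? h l)
... | false = length-filter-map P? h l

length-filter-binVecs : (n : ℕ) {P : Vec ℕ n → Set} (P? : Decidable P) →
  length (filter P? (binVecs n)) ≡ countBin n (λ x → does (P? x))
length-filter-binVecs zero P? with does (P? [])
... | true  = refl
... | false = refl
length-filter-binVecs (suc n) P? = begin
  length (filter P? (map (0 ∷_) bs ++ map (1 ∷_) bs))
    ≡⟨ cong length (filter-++ P? (map (0 ∷_) bs) (map (1 ∷_) bs)) ⟩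
  length (filter P? (map (0 ∷_) bs) ++ filter P? (map (1 ∷_) bs))
    ≡⟨ length-++ (filter P? (map (0 ∷_) bs)) ⟩
  length (filter P? (map (0 ∷_) bs)) + length (filter P? (map (1 ∷_) bs))
    ≡⟨ cong₂ _+_ (count-prefix 0) (count-prefix 1) ⟩
  countBin (suc n) (λ x → does (P? x)) ∎
  where
  open ≡-Reasoning
  bs = binVecs n
  count-prefix : (b : ℕ) →
    length (filter P? (map (b ∷_) bs)) ≡ countBin n (λ x → does (P? (b ∷ x)))
  count-prefix b = trans (length-filter-map P? (b ∷_) bs) (length-filter-binVecs n (P? ∘ (b ∷_)))

countBin-false : (n : ℕ) → countBin n (λ _ → false) ≡ 0
countBin-false zero    = refl
countBin-false (suc n) = cong₂ _+_ (countBin-false n) (countBin-false n)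

countBin-∧ : (n : ℕ) (c : Bool) (p : Vec ℕ n → Bool) →
  countBin n (λ x → c ∧ p x) ≡ bit c * countBin n p
countBin-∧ n true  p = sym (+-identityʳ _)
countBin-∧ n false p = countBin-false n

-- 2×2 matrices over ℕ; rows and columns are indexed by the bits 0 and 1.
record Mat : Set where
  constructor mat
  field
    m₀₀ m₀₁ m₁₀ m₁₁ : ℕ
open Mat

mul : Mat → Mat → Mat
mul P Q = mat (m₀₀ P * m₀₀ Q + m₀₁ P * m₁₀ Q) (m₀₀ P * m₀₁ Q + m₀₁ P * m₁₁ Q)
              (m₁₀ P * m₀₀ Q + m₁₁ P * m₁₀ Q) (m₁₀ P * m₀₁ Q + m₁₁ P * m₁₁ Q)

I₂ : Mat
I₂ = mat 1 0 0 1

tr : Mat → ℕ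
tr P = m₀₀ P + m₁₁ P

entry : Mat → Bool → Bool → ℕ
entry P false false = m₀₀ P
entry P false true  = m₀₁ P
entry P true  false = m₁₀ P
entry P true  true  = m₁₁ P

entry-mul : (P Q : Mat) (x y : Bool) →
  entry (mul P Q) x y ≡ entry P x false * entry Q false y + entry P x true * entry Q true y
entry-mul P Q false false = refl
entry-mul P Q false true  = refl
entry-mul P Q true  false = refl
entry-mul P Q true  true  = refl

mat-cong : ∀ {a b c d a′ b′ c′ d′} → a ≡ a′ → b ≡ b′ → c ≡ c′ → d ≡ d′ →
  mat a b c d ≡ mat a′ b′ c′ d′
mat-cong refl refl refl refl = refl

mul-identityˡ : (P : Mat) → mul I₂ P ≡ P
mul-identityˡ (mat a b c d) = mat-cong (law a c) (law b d) (law′ a c) (law′ b d)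
  where
  law : ∀ x y → 1 * x + 0 * y ≡ x
  law = solve-∀
  law′ : ∀ x y → 0 * x + 1 * y ≡ y
  law′ = solve-∀

mul-identityʳ : (P : Mat) → mul P I₂ ≡ P
mul-identityʳ (mat a b c d) = mat-cong (law a b) (law′ a b) (law c d) (law′ c d)
  where
  law : ∀ x y → x * 1 + y * 0 ≡ x
  law = solve-∀
  law′ : ∀ x y → x * 0 + y * 1 ≡ y
  law′ = solve-∀

mul-assoc : (P Q R : Mat) → mul (mul P Q) R ≡ mul P (mul Q R)
mul-assoc (mat a b c d) (mat a′ b′ c′ d′) (mat a″ b″ c″ d″) =
  mat-cong (law a b a′ b′ c′ d′ a″ c″) (law a b a′ b′ c′ d′ b″ d″)
           (law c d a′ b′ c′ d′ a″ c″) (law c d a′ b′ c′ d′ b″ d″)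
  where
  law : ∀ x y p q r s u v → (x * p + y * r) * u + (x * q + y * s) * v
                          ≡ x * (p * u + q * v) + y * (r * u + s * v)
  law = solve-∀

transfer : ℕ → Mat
transfer t = mat (admissible 0 0) (admissible 0 1) (admissible 1 0) (admissible 1 1)
  where
  admissible : ℕ → ℕ → ℕ
  admissible x y = bit (does (avoids? (x , y , t)))

entry-transfer : (t : ℕ) (x y : Bool) →
  entry (transfer t) x y ≡ bit (does (avoids? (bit x , bit y , t)))
entry-transfer t false false = refl
entry-transfer t false true  = refl
entry-transfer t true  false = refl
entry-transfer t true  true  = refl

prod : List ℕ → Mat
prod []      = I₂
prod (t ∷ w) = mul (transfer t) (prod w)

prod-++ : (u v : List ℕ) → prod (u ++ v) ≡ mul (prod u) (prod v)
prod-++ []      v = sym (mul-identityˡ (prod v))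
prod-++ (t ∷ u) v = begin
  mul (transfer t) (prod (u ++ v))         ≡⟨ cong (mul (transfer t)) (prod-++ u v) ⟩
  mul (transfer t) (mul (prod u) (prod v)) ≡⟨ sym (mul-assoc (transfer t) (prod u) (prod v)) ⟩
  mul (prod (t ∷ u)) (prod v)              ∎
  where open ≡-Reasoning

-- In the inductive step one splits on the second bit y; the constraint between x
-- and y then factors out of the count as the entry (x, y) of M t.
count-chain : ∀ {m} (s : Vec ℕ (suc m)) (x f : Bool) →
  countBin m (λ xs → does (all? avoids? (chain (bit f) (bit x ∷ xs) s)))
    ≡ entry (prod (toList s)) x f
count-chain (t ∷ []) x f = begin
  bit (does (avoids? (bit x , bit f , t)) ∧ true) ≡⟨ cong bit (∧-identityʳ _) ⟩
  bit (does (avoids? (bit x , bit f , t)))        ≡⟨ sym (entry-transfer t x f) ⟩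
  entry (transfer t) x f                          ≡⟨ cong (λ P → entry P x f) (sym (mul-identityʳ (transfer t))) ⟩
  entry (mul (transfer t) I₂) x f                 ∎
  where open ≡-Reasoning
count-chain {suc m} (t ∷ t′ ∷ ts) x f = begin
  countBin m (λ xs → c₀ ∧ h false xs) + countBin m (λ xs → c₁ ∧ h true xs)
    ≡⟨ cong₂ _+_ (countBin-∧ m c₀ (h false)) (countBin-∧ m c₁ (h true)) ⟩
  bit c₀ * countBin m (h false) + bit c₁ * countBin m (h true)
    ≡⟨ cong₂ _+_ (cong (bit c₀ *_) (count-chain (t′ ∷ ts) false f))
                 (cong (bit c₁ *_) (count-chain (t′ ∷ ts) true f)) ⟩
  bit c₀ * entry Q false f + bit c₁ * entry Q true f
    ≡⟨ cong₂ _+_ (cong (_* entry Q false f) (sym (entry-transfer t x false)))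
                 (cong (_* entry Q true f) (sym (entry-transfer t x true))) ⟩
  entry (transfer t) x false * entry Q false f + entry (transfer t) x true * entry Q true f
    ≡⟨ sym (entry-mul (transfer t) Q x f) ⟩
  entry (mul (transfer t) Q) x f ∎
  where
  open ≡-Reasoning
  Q  = prod (toList (t′ ∷ ts))
  c₀ = does (avoids? (bit x , 0 , t))
  c₁ = does (avoids? (bit x , 1 , t))
  h : Bool → Vec ℕ m → Bool
  h y xs = does (all? avoids? (chain (bit f) (bit y ∷ xs) (t′ ∷ ts)))

cardGood-trace : ∀ {m} (s : Vec ℕ (suc m)) → cardGood s ≡ tr (prod (toList s))
cardGood-trace {m} s = begin
  length (filter (Good? s) (binVecs (suc m)))
    ≡⟨ length-filter-binVecs (suc m) (Good? s) ⟩
  countBin (suc m) (λ x → does (Good? s x))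
    ≡⟨ cong₂ _+_ (count-chain s false false) (count-chain s true true) ⟩
  tr (prod (toList s)) ∎
  where open ≡-Reasoning

fib-mono : (n : ℕ) → fib n ≤ fib (suc n)
fib-mono zero          = z≤n
fib-mono (suc zero)    = s≤s z≤n
fib-mono (suc (suc n)) = m≤m+n (fib (suc (suc n))) (fib (suc n))

-- The invariant of a column (x, y) of a product of k transfer matrices with
-- letters ≤ 2: x, y ≤ φ(k+1) and x + y ≤ φ(k+2).
FibColumn : ℕ → ℕ → ℕ → Set
FibColumn k x y = x ≤ fib (suc k) × y ≤ fib (suc k) × x + y ≤ fib (suc (suc k))

-- Left multiplication by M 0, M 1, M 2 sends a column (x, y) to
-- (y, x + y), (x, y), (x + y, x) respectively; each preserves the invariant.
column-0 : ∀ {k x y} → FibColumn k x y → FibColumn (suc k) y (x + y)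
column-0 {k} {x} {y} (x≤ , y≤ , x+y≤) =
  ≤-trans y≤ (fib-mono (suc k)) , x+y≤ ,
  subst (_≤ fib (suc (suc (suc k)))) (+-comm (x + y) y) (+-mono-≤ x+y≤ y≤)

column-1 : ∀ {k x y} → FibColumn k x y → FibColumn (suc k) x y
column-1 {k} (x≤ , y≤ , x+y≤) =
  ≤-trans x≤ (fib-mono (suc k)) , ≤-trans y≤ (fib-mono (suc k)) ,
  ≤-trans x+y≤ (fib-mono (suc (suc k)))

column-2 : ∀ {k x y} → FibColumn k x y → FibColumn (suc k) (x + y) x
column-2 {k} (x≤ , y≤ , x+y≤) = x+y≤ , ≤-trans x≤ (fib-mono (suc k)) , +-mono-≤ x+y≤ x≤

ColumnsBounded : ℕ → Mat → Set
ColumnsBounded k P = FibColumn k (m₀₀ P) (m₁₀ P) × FibColumn k (m₀₁ P) (m₁₁ P)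

transfer-0-mul : (P : Mat) →
  mul (transfer 0) P ≡ mat (m₁₀ P) (m₁₁ P) (m₀₀ P + m₁₀ P) (m₀₁ P + m₁₁ P)
transfer-0-mul (mat a b c d) = mat-cong (law a c) (law b d) (law′ a c) (law′ b d)
  where
  law : ∀ x y → 0 * x + 1 * y ≡ y
  law = solve-∀
  law′ : ∀ x y → 1 * x + 1 * y ≡ x + y
  law′ = solve-∀

transfer-2-mul : (P : Mat) →
  mul (transfer 2) P ≡ mat (m₀₀ P + m₁₀ P) (m₀₁ P + m₁₁ P) (m₀₀ P) (m₀₁ P)
transfer-2-mul (mat a b c d) = mat-cong (law′ a c) (law′ b d) (law a c) (law b d)
  where
  law : ∀ x y → 1 * x + 0 * y ≡ x
  law = solve-∀
  law′ : ∀ x y → 1 * x + 1 * y ≡ x + y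
  law′ = solve-∀

columns-bounded : (w : List ℕ) → List.All (_≤ 2) w → ColumnsBounded (length w) (prod w)
columns-bounded [] [] = (s≤s z≤n , z≤n , s≤s z≤n) , (z≤n , s≤s z≤n , s≤s z≤n)
columns-bounded (0 ∷ w) (_ ∷ A) with columns-bounded w A
... | c₁ , c₂ = subst (ColumnsBounded (suc (length w))) (sym (transfer-0-mul (prod w)))
                      (column-0 {length w} c₁ , column-0 {length w} c₂)
columns-bounded (1 ∷ w) (_ ∷ A) with columns-bounded w A
... | c₁ , c₂ = subst (ColumnsBounded (suc (length w))) (sym (mul-identityˡ (prod w)))
                      (column-1 {length w} c₁ , column-1 {length w} c₂)
columns-bounded (2 ∷ w) (_ ∷ A) with columns-bounded w A
... | c₁ , c₂ = subst (ColumnsBounded (suc (length w))) (sym (transfer-2-mul (prod w)))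
                      (column-2 {length w} c₁ , column-2 {length w} c₂)
columns-bounded (suc (suc (suc _)) ∷ _) (s≤s (s≤s ()) ∷ _)

power-0 : (w : List ℕ) → List.All (_≡ 0) w →
  prod (0 ∷ w) ≡ mat (fib (length w)) (fib (suc (length w)))
                     (fib (suc (length w))) (fib (suc (suc (length w))))
power-0 []      []           = refl
power-0 (_ ∷ w) (refl ∷ Z) = begin
  mul (transfer 0) (prod (0 ∷ w))
    ≡⟨ cong (mul (transfer 0)) (power-0 w Z) ⟩
  mul (transfer 0) (mat (fib j) (fib (suc j)) (fib (suc j)) (fib (suc (suc j))))
    ≡⟨ transfer-0-mul (mat (fib j) (fib (suc j)) (fib (suc j)) (fib (suc (suc j)))) ⟩
  mat (fib (suc j)) (fib (suc (suc j))) (fib j + fib (suc j)) (fib (suc j) + fib (suc (suc j)))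
    ≡⟨ mat-cong refl refl (+-comm (fib j) _) (+-comm (fib (suc j)) _) ⟩
  mat (fib (suc j)) (fib (suc (suc j))) (fib (suc (suc j))) (fib (suc (suc (suc j)))) ∎
  where
  open ≡-Reasoning
  j = length w

power-2 : (w : List ℕ) → List.All (_≡ 2) w →
  prod (2 ∷ w) ≡ mat (fib (suc (suc (length w)))) (fib (suc (length w)))
                     (fib (suc (length w))) (fib (length w))
power-2 []      []           = refl
power-2 (_ ∷ w) (refl ∷ Z) =
  trans (cong (mul (transfer 2)) (power-2 w Z))
        (transfer-2-mul (mat (fib (suc (suc j))) (fib (suc j)) (fib (suc j)) (fib j)))
  where j = length w

data Clash : ℕ → ℕ → Set where
  clash-02 : Clash 0 2
  clash-20 : Clash 2 0

-- The off-diagonal entry that a clash doubles.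
off : ∀ {a b} → Clash a b → Mat → ℕ
off clash-02 = m₀₁
off clash-20 = m₁₀

-- With N = M a · M b ∈ {(1 0 / 2 1), (1 2 / 0 1)}:  tr (U N V) = tr (V U) + 2 · off (V U).
-- Each law below is this identity with both sides unfolded entrywise.
tr-sandwich : ∀ {a b} (p : Clash a b) (U V : Mat) →
  tr (mul U (mul (mul (transfer a) (transfer b)) V)) ≡ tr (mul V U) + 2 * off p (mul V U)
tr-sandwich clash-02 (mat a b c d) (mat a′ b′ c′ d′) = law a b c d a′ b′ c′ d′
  where
  law : ∀ a b c d a′ b′ c′ d′ →
    (a * (1 * a′ + 0 * c′) + b * (2 * a′ + 1 * c′)) + (c * (1 * b′ + 0 * d′) + d * (2 * b′ + 1 * d′))
      ≡ (a′ * a + b′ * c + (c′ * b + d′ * d)) + 2 * (a′ * b + b′ * d)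
  law = solve-∀
tr-sandwich clash-20 (mat a b c d) (mat a′ b′ c′ d′) = law a b c d a′ b′ c′ d′
  where
  law : ∀ a b c d a′ b′ c′ d′ →
    (a * (1 * a′ + 2 * c′) + b * (0 * a′ + 1 * c′)) + (c * (1 * b′ + 2 * d′) + d * (0 * b′ + 1 * d′))
      ≡ (a′ * a + b′ * c + (c′ * b + d′ * d)) + 2 * (c′ * a + d′ * c)
  law = solve-∀

tr-clash : ∀ {a b} (p : Clash a b) (u v : List ℕ) →
  tr (prod (u ++ a ∷ b ∷ v)) ≡ tr (prod (v ++ u)) + 2 * off p (prod (v ++ u))
tr-clash {a} {b} p u v = begin
  tr (prod (u ++ a ∷ b ∷ v))
    ≡⟨ cong tr (prod-++ u (a ∷ b ∷ v)) ⟩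
  tr (mul (prod u) (mul (transfer a) (mul (transfer b) (prod v))))
    ≡⟨ cong (tr ∘ mul (prod u)) (sym (mul-assoc (transfer a) (transfer b) (prod v))) ⟩
  tr (mul (prod u) (mul (mul (transfer a) (transfer b)) (prod v)))
    ≡⟨ tr-sandwich p (prod u) (prod v) ⟩
  tr (mul (prod v) (prod u)) + 2 * off p (mul (prod v) (prod u))
    ≡⟨ cong (λ P → tr P + 2 * off p P) (sym (prod-++ v u)) ⟩
  tr (prod (v ++ u)) + 2 * off p (prod (v ++ u)) ∎
  where open ≡-Reasoning

off-bound : ∀ {a b} (p : Clash a b) (z : List ℕ) → List.All (_≤ 2) z →
  off p (prod z) ≤ fib (suc (length z))
off-bound clash-02 z A = proj₁ (proj₂ (columns-bounded z A))
off-bound clash-20 z A = proj₁ (proj₂ (proj₁ (columns-bounded z A)))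

-- ℓ(n), raised to 2 for n ≤ 1 where the identity (the empty word, or the word 1)
-- has trace 2.
traceBound : ℕ → ℕ
traceBound zero          = 2
traceBound (suc zero)    = 2
traceBound (suc (suc k)) = lucas (suc (suc k))

traceBound-mono : (n : ℕ) → traceBound n ≤ traceBound (suc n)
traceBound-mono zero          = ≤-refl
traceBound-mono (suc zero)    = s≤s (s≤s z≤n)
traceBound-mono (suc (suc k)) = +-mono-≤ (fib-mono (suc k)) (fib-mono (suc (suc (suc k))))

lucas≤traceBound : (j : ℕ) → lucas (suc j) ≤ traceBound (suc j)
lucas≤traceBound zero    = s≤s z≤n
lucas≤traceBound (suc j) = ≤-refl

-- The arithmetic of a clash: ℓ(j+1) + 2φ(j+2) ≤ ℓ(j+3), since
-- ℓ(j+3) = φ(j+2) + φ(j+4) = φ(j+1) + 3φ(j+2) and ℓ(j+1) ≤ φ(j+1) + φ(j+2).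
traceBound-clash : (j x y : ℕ) → x ≤ traceBound (suc j) → y ≤ fib (suc (suc j)) →
  x + 2 * y ≤ traceBound (suc (suc (suc j)))
traceBound-clash zero    x y x≤ y≤ = +-mono-≤ x≤ (*-monoʳ-≤ 2 y≤)
traceBound-clash (suc i) x y x≤ y≤ = begin
  x + 2 * y            ≤⟨ +-mono-≤ x≤ (*-monoʳ-≤ 2 y≤) ⟩
  (B + D) + 2 * D      ≤⟨ +-monoˡ-≤ (2 * D) (+-monoˡ-≤ D (fib-mono (suc i))) ⟩
  (C + D) + 2 * D      ≡⟨ law C D ⟩
  D + ((D + C) + D)    ∎
  where
  open ≤-Reasoning
  B = fib (suc i)
  C = fib (suc (suc i))
  D = C + B
  law : ∀ C D → (C + D) + 2 * D ≡ D + ((D + C) + D)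
  law = solve-∀

clash-step : ∀ {a b} (p : Clash a b) (z : List ℕ) → List.All (_≤ 2) z →
  tr (prod z) ≤ traceBound (length z) →
  tr (prod z) + 2 * off p (prod z) ≤ traceBound (suc (suc (length z)))
clash-step clash-02 []      _ _   = s≤s (s≤s z≤n)
clash-step clash-20 []      _ _   = s≤s (s≤s z≤n)
clash-step p        (t ∷ z) A tr≤ = traceBound-clash (length z) _ _ tr≤ (off-bound p (t ∷ z) A)

data Shape (w : List ℕ) : Set where
  has-one   : (u v : List ℕ) → w ≡ u ++ 1 ∷ v → Shape w
  has-clash : ∀ {a b} → Clash a b → (u v : List ℕ) → w ≡ u ++ a ∷ b ∷ v → Shape w
  all-0     : List.All (_≡ 0) w → Shape w
  all-2     : List.All (_≡ 2) w → Shape w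

shape : (w : List ℕ) → List.All (_≤ 2) w → Shape w
shape []      []      = all-0 []
shape (1 ∷ w) _       = has-one [] w refl
shape (0 ∷ w) (_ ∷ A) with shape w A
... | has-one u v refl     = has-one (0 ∷ u) v refl
... | has-clash p u v refl = has-clash p (0 ∷ u) v refl
... | all-0 Z              = all-0 (refl ∷ Z)
... | all-2 []             = all-0 (refl ∷ [])
... | all-2 (refl ∷ Z)     = has-clash clash-02 [] _ refl
shape (2 ∷ w) (_ ∷ A) with shape w A
... | has-one u v refl     = has-one (2 ∷ u) v refl
... | has-clash p u v refl = has-clash p (2 ∷ u) v refl
... | all-2 Z              = all-2 (refl ∷ Z)
... | all-0 []             = all-2 (refl ∷ [])
... | all-0 (refl ∷ Z)     = has-clash clash-20 [] _ refl
shape (suc (suc (suc _)) ∷ _) (s≤s (s≤s ()) ∷ _)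

prod-delete-1 : (u v : List ℕ) → prod (u ++ 1 ∷ v) ≡ prod (u ++ v)
prod-delete-1 u v = begin
  prod (u ++ 1 ∷ v)                     ≡⟨ prod-++ u (1 ∷ v) ⟩
  mul (prod u) (mul I₂ (prod v))        ≡⟨ cong (mul (prod u)) (mul-identityˡ (prod v)) ⟩
  mul (prod u) (prod v)                 ≡⟨ sym (prod-++ u v) ⟩
  prod (u ++ v)                         ∎
  where open ≡-Reasoning

All-delete : {P : ℕ → Set} (u : List ℕ) {x : ℕ} (v : List ℕ) →
  List.All P (u ++ x ∷ v) → List.All P (u ++ v)
All-delete u v A = ++⁺ (++⁻ˡ u A) (List.tail (++⁻ʳ u A))

All-rotate : {P : ℕ → Set} (u : List ℕ) {x y : ℕ} (v : List ℕ) →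
  List.All P (u ++ x ∷ y ∷ v) → List.All P (v ++ u)
All-rotate u v A = ++⁺ (List.tail (List.tail (++⁻ʳ u A))) (++⁻ˡ u A)

length-rotate : (u : List ℕ) {x y : ℕ} (v : List ℕ) →
  length (u ++ x ∷ y ∷ v) ≡ suc (suc (length (v ++ u)))
length-rotate u {x} {y} v = begin
  length (u ++ x ∷ y ∷ v)        ≡⟨ length-++-sucʳ u x (y ∷ v) ⟩
  suc (length (u ++ y ∷ v))      ≡⟨ cong suc (length-++-sucʳ u y v) ⟩
  suc (suc (length (u ++ v)))    ≡⟨ cong (suc ∘ suc) (length-++-comm u v) ⟩
  suc (suc (length (v ++ u)))    ∎
  where open ≡-Reasoning

tr-constant-0 : (w : List ℕ) → List.All (_≡ 0) w → tr (prod w) ≤ traceBound (length w)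
tr-constant-0 []      []         = ≤-refl
tr-constant-0 (_ ∷ w) (refl ∷ Z) =
  ≤-trans (≤-reflexive (cong tr (power-0 w Z))) (lucas≤traceBound (length w))

tr-constant-2 : (w : List ℕ) → List.All (_≡ 2) w → tr (prod w) ≤ traceBound (length w)
tr-constant-2 []      []         = ≤-refl
tr-constant-2 (_ ∷ w) (refl ∷ Z) =
  ≤-trans (≤-reflexive (trans (cong tr (power-2 w Z)) (+-comm (fib (suc (suc j))) (fib j))))
          (lucas≤traceBound j)
  where j = length w

trace-bound : (w : List ℕ) → List.All (_≤ 2) w → tr (prod w) ≤ traceBound (length w)
trace-bound w = bounded (length w) w ≤-refl
  where
  open ≤-Reasoning
  bounded : (k : ℕ) (w : List ℕ) → length w ≤ k → List.All (_≤ 2) w →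
    tr (prod w) ≤ traceBound (length w)
  bounded zero    []      _  _ = ≤-refl
  bounded zero    (_ ∷ _) () _
  bounded (suc k) w |w|≤ A with shape w A
  ... | has-one u v refl = begin
    tr (prod (u ++ 1 ∷ v))              ≡⟨ cong tr (prod-delete-1 u v) ⟩
    tr (prod (u ++ v))                  ≤⟨ bounded k (u ++ v) |u++v|≤ (All-delete u v A) ⟩
    traceBound (length (u ++ v))        ≤⟨ traceBound-mono (length (u ++ v)) ⟩
    traceBound (suc (length (u ++ v)))  ≡⟨ cong traceBound (sym (length-++-sucʳ u 1 v)) ⟩
    traceBound (length (u ++ 1 ∷ v))    ∎
    where
    |u++v|≤ : length (u ++ v) ≤ k
    |u++v|≤ = ≤-pred (subst (_≤ suc k) (length-++-sucʳ u 1 v) |w|≤)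
  ... | has-clash {a} {b} p u v refl = begin
    tr (prod (u ++ a ∷ b ∷ v))          ≡⟨ tr-clash p u v ⟩
    tr (prod z) + 2 * off p (prod z)    ≤⟨ clash-step p z Az (bounded k z |z|≤ Az) ⟩
    traceBound (suc (suc (length z)))   ≡⟨ cong traceBound (sym (length-rotate u v)) ⟩
    traceBound (length (u ++ a ∷ b ∷ v)) ∎
    where
    z = v ++ u
    Az : List.All (_≤ 2) z
    Az = All-rotate u v A
    |z|≤ : length z ≤ k
    |z|≤ = ≤-trans (n≤1+n (length z)) (≤-pred (subst (_≤ suc k) (length-rotate u v) |w|≤))
  ... | all-0 Z = tr-constant-0 w Z
  ... | all-2 Z = tr-constant-2 w Z

lemma3p1 : (n : ℕ) → 2 ≤ n → (s : Vec ℕ n) → All (λ t → t ≤ 2) s →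
    cardGood s ≤ lucas n
lemma3p1 (suc zero)    (s≤s ()) s s≤2
lemma3p1 (suc (suc k)) _        s s≤2 = begin
  cardGood s                       ≡⟨ cardGood-trace s ⟩
  tr (prod (toList s))             ≤⟨ trace-bound (toList s) (toList⁺ s≤2) ⟩
  traceBound (length (toList s))   ≡⟨ cong traceBound (length-toList s) ⟩
  lucas (suc (suc k))              ∎
  where open ≤-Reasoning
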